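{- Let $k\geq 2$ and $0\leq \alpha\leq k$ be integers. If $A$ is a set of $k$ nonnegative integers with $0\in A$, then \[|\Sigma_{\alpha}(A)|\geq \frac{(k-1)k}{2}-\frac{(\alpha-1)\alpha}{2}+1.\] Moreover, this lower bound is best possible, i.e., it is attained by some set of $k$ nonnegative integers containing $0$.
   Context: For a finite set $A$ of integers with $|A|=k$ and an integer $0\leq\alpha\leq k$, $\Sigma_{\alpha}(A)=\{s(B): B\subseteq A,\ |B|\geq \alpha\}$, where $s(B)=\sum_{b\in B} b$ and $s(\emptyset)=0$. -}

module Defs where

open import Data.Nat using (ℕ; zero; suc; _+_; _*_; _∸_; _≤_; _≤?_; _≟_; _/_)
open import Data.Bool using (Bool; true; false)
open import Data.Vec using (Vec; []; _∷_)
open import Data.List using (List; []; _∷_; map; filter; length; deduplicate; _++_)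
open import Data.Fin.Subset using (Subset; ∣_∣)

allSubsets : (k : ℕ) → List (Subset k)
allSubsets zero = [] ∷ []
allSubsets (suc k) = map (true ∷_) (allSubsets k) ++ map (false ∷_) (allSubsets k)

subsetSum : {k : ℕ} → Vec ℕ k → Subset k → ℕ
subsetSum [] [] = 0
subsetSum (x ∷ xs) (true ∷ b) = x + subsetSum xs b
subsetSum (x ∷ xs) (false ∷ b) = subsetSum xs b

sigmaList : {k : ℕ} → Vec ℕ k → ℕ → List ℕ
sigmaList {k} a α = map (subsetSum a) (filter (λ B → α ≤? ∣ B ∣) (allSubsets k))

cardSigma : {k : ℕ} → Vec ℕ k → ℕ → ℕ
cardSigma a α = length (deduplicate _≟_ (sigmaList a α))

-- (k-1)k/2 - (α-1)α/2 + 1   (exact divisions; α = 0 gives (α-1)α/2 = 0)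
bound : ℕ → ℕ → ℕ
bound k α = ((k ∸ 1) * k) / 2 ∸ ((α ∸ 1) * α) / 2 + 1

module Submission where

-- Write T n = 0 + 1 + ... + (n-1) = (n-1)n/2, so the bound is T k - T α + 1.
--
-- Lower bound.  If α = k there is the single sum s(A).  Otherwise let M be the
-- largest element and A' = A \ {M}.  By induction Σ_α(A') has at least
-- T (k-1) - T α + 1 elements, all at most s(A').  The k-1 sums
-- M + s(A' \ {x}), x ∈ A', come from subsets of size k-1 ≥ α, are pairwise
-- distinct and all exceed s(A') because x < M.  Since T k = T (k-1) + (k-1)
-- this gives T k - T α + 1 distinct elements of Σ_α(A).
--
-- Sharpness.  For A = {0, 1, ..., k-1} a subset of size j ≥ α has sum at
-- least 0 + ... + (j-1) = T j ≥ T α and at most s(A) = T k, so Σ_α(A) lies in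
-- an interval with T k - T α + 1 points.

open import Defs
open import Data.Nat using (ℕ; zero; suc; _+_; _*_; _∸_; _≤_; _<_; _≥_; z≤n; s≤s; _≤?_; _≟_; _/_)
open import Data.Nat.Properties
open import Data.Nat.DivMod using (m*n/n≡m)
open import Data.Nat.Tactic.RingSolver using (solve-∀)
open import Data.Bool using (true; false)
open import Data.Fin as Fin using (Fin; punchIn)
open import Data.Fin.Properties using (punchIn-injective; punchInᵢ≢i)
open import Data.Fin.Subset using (Subset; ∣_∣)
open import Data.Vec using (Vec; lookup; []; _∷_; insertAt; removeAt)
open import Data.Vec.Properties using (insertAt-removeAt; insertAt-punchIn)
open import Data.List using (List; []; _∷_; map; length; deduplicate; _++_; allFin; upTo)
open import Data.List.Properties using (length-++; length-map; length-tabulate; length-upTo)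
open import Data.List.Membership.Propositional using (_∈_)
open import Data.List.Membership.Propositional.Properties
open import Data.List.Relation.Unary.Any using (here; there)
open import Data.List.Relation.Unary.All as All using ()
open import Data.List.Relation.Unary.AllPairs as AllPairs using ()
open import Data.List.Relation.Unary.Unique.Propositional using (Unique)
open import Data.List.Relation.Unary.Unique.DecPropositional.Properties _≟_ using (deduplicate-!; ++⁺; map⁺; allFin⁺)
open import Data.Product using (Σ; ∃; _×_; _,_; proj₂)
open import Data.Sum using (inj₁; inj₂)
open import Data.Empty using (⊥-elim)
open import Relation.Nullary using (¬_; yes; no)
open import Relation.Binary.PropositionalEquality

removeMember : ∀ {x : ℕ} (ys : List ℕ) → x ∈ ys → List ℕ
removeMember (y ∷ ys) (here _) = ys
removeMember (y ∷ ys) (there p) = y ∷ removeMember ys p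

length-removeMember : ∀ {x : ℕ} (ys : List ℕ) (p : x ∈ ys) →
                      suc (length (removeMember ys p)) ≡ length ys
length-removeMember (y ∷ ys) (here _) = refl
length-removeMember (y ∷ ys) (there p) = cong suc (length-removeMember ys p)

∈-removeMember : ∀ {x y : ℕ} (ys : List ℕ) (p : x ∈ ys) → y ∈ ys → x ≢ y → y ∈ removeMember ys p
∈-removeMember (z ∷ ys) (here x≡z) (here y≡z) x≢y = ⊥-elim (x≢y (trans x≡z (sym y≡z)))
∈-removeMember (z ∷ ys) (there p) (here y≡z) x≢y = here y≡z
∈-removeMember (z ∷ ys) (here x≡z) (there q) x≢y = q
∈-removeMember (z ∷ ys) (there p) (there q) x≢y = there (∈-removeMember ys p q x≢y)

unique-⊆⇒length-≤ : ∀ (xs ys : List ℕ) → Unique xs → (∀ {v} → v ∈ xs → v ∈ ys) →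
                    length xs ≤ length ys
unique-⊆⇒length-≤ [] ys _ _ = z≤n
unique-⊆⇒length-≤ (x ∷ xs) ys (x∉xs AllPairs.∷ uxs) xs⊆ys =
  subst (suc (length xs) ≤_) (length-removeMember ys x∈ys)
    (s≤s (unique-⊆⇒length-≤ xs (removeMember ys x∈ys) uxs xs⊆ys-x))
  where
  x∈ys = xs⊆ys (here refl)
  xs⊆ys-x : ∀ {v} → v ∈ xs → v ∈ removeMember ys x∈ys
  xs⊆ys-x v∈xs = ∈-removeMember ys x∈ys (xs⊆ys (there v∈xs)) (All.lookup x∉xs v∈xs)

T : ℕ → ℕ
T zero = 0
T (suc n) = n + T n

gauss : ∀ n → n * suc n ≡ (n + T n) * 2
gauss zero = refl
gauss (suc n) = begin
    suc n * suc (suc n)       ≡⟨ peel n ⟩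
    suc n * 2 + n * suc n     ≡⟨ cong (suc n * 2 +_) (gauss n) ⟩
    suc n * 2 + (n + T n) * 2 ≡⟨ sym (*-distribʳ-+ 2 (suc n) (n + T n)) ⟩
    (suc n + (n + T n)) * 2   ∎
  where
  open ≡-Reasoning
  peel : ∀ n → suc n * suc (suc n) ≡ suc n * 2 + n * suc n
  peel = solve-∀

T-closedForm : ∀ n → ((n ∸ 1) * n) / 2 ≡ T n
T-closedForm zero = refl
T-closedForm (suc n) = trans (cong (_/ 2) (gauss n)) (m*n/n≡m (n + T n) 2)

bound≡ : ∀ k α → bound k α ≡ T k ∸ T α + 1
bound≡ k α rewrite T-closedForm k | T-closedForm α = refl

T-mono : ∀ {m n} → m ≤ n → T m ≤ T n
T-mono {zero} _ = z≤n
T-mono {suc m} {suc n} (s≤s m≤n) = +-mono-≤ m≤n (T-mono m≤n)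

T-interval-step : ∀ m α → α ≤ m → T m ∸ T α + 1 + m ≡ T (suc m) ∸ T α + 1
T-interval-step m α α≤m = begin
    T m ∸ T α + 1 + m   ≡⟨ +-comm (T m ∸ T α + 1) m ⟩
    m + (T m ∸ T α + 1) ≡⟨ sym (+-assoc m _ 1) ⟩
    m + (T m ∸ T α) + 1 ≡⟨ cong (_+ 1) (sym (+-∸-assoc m (T-mono α≤m))) ⟩
    m + T m ∸ T α + 1   ∎
  where open ≡-Reasoning

full : ∀ n → Subset n
full zero = []
full (suc n) = true ∷ full n

total : ∀ {n} → Vec ℕ n → ℕ
total {n} a = subsetSum a (full n)

∣full∣ : ∀ n → ∣ full n ∣ ≡ n
∣full∣ zero = refl
∣full∣ (suc n) = cong suc (∣full∣ n)

∣B∣≤n : ∀ {n} (B : Subset n) → ∣ B ∣ ≤ n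
∣B∣≤n [] = z≤n
∣B∣≤n (true ∷ B) = s≤s (∣B∣≤n B)
∣B∣≤n (false ∷ B) = m≤n⇒m≤1+n (∣B∣≤n B)

subsetSum≤total : ∀ {n} (a : Vec ℕ n) (B : Subset n) → subsetSum a B ≤ total a
subsetSum≤total [] [] = z≤n
subsetSum≤total (x ∷ a) (true ∷ B) = +-monoʳ-≤ x (subsetSum≤total a B)
subsetSum≤total (x ∷ a) (false ∷ B) = m≤n⇒m≤o+n x (subsetSum≤total a B)

allBut : ∀ {n} → Fin n → Subset n
allBut {suc n} Fin.zero = false ∷ full n
allBut (Fin.suc i) = true ∷ allBut i

allBut-sum : ∀ {n} (a : Vec ℕ n) (i : Fin n) → subsetSum a (allBut i) + lookup a i ≡ total a
allBut-sum (x ∷ a) Fin.zero = +-comm (total a) x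
allBut-sum (x ∷ a) (Fin.suc i) = trans (+-assoc x _ _) (cong (x +_) (allBut-sum a i))

∣allBut∣ : ∀ {n} (i : Fin n) → suc ∣ allBut i ∣ ≡ n
∣allBut∣ {suc n} Fin.zero = cong suc (∣full∣ n)
∣allBut∣ (Fin.suc i) = cong suc (∣allBut∣ i)

insertAt-false-sum : ∀ {m} (a : Vec ℕ m) p M (B : Subset m) →
                     subsetSum (insertAt a p M) (insertAt B p false) ≡ subsetSum a B
insertAt-false-sum a Fin.zero M B = refl
insertAt-false-sum (x ∷ a) (Fin.suc p) M (true ∷ B) = cong (x +_) (insertAt-false-sum a p M B)
insertAt-false-sum (x ∷ a) (Fin.suc p) M (false ∷ B) = insertAt-false-sum a p M B

insertAt-true-sum : ∀ {m} (a : Vec ℕ m) p M (B : Subset m) →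
                    subsetSum (insertAt a p M) (insertAt B p true) ≡ M + subsetSum a B
insertAt-true-sum a Fin.zero M B = refl
insertAt-true-sum (x ∷ a) (Fin.suc p) M (true ∷ B) = begin
    x + subsetSum (insertAt a p M) (insertAt B p true) ≡⟨ cong (x +_) (insertAt-true-sum a p M B) ⟩
    x + (M + subsetSum a B)                            ≡⟨ x+[y+z]≡y+[x+z] x M (subsetSum a B) ⟩
    M + (x + subsetSum a B)                            ∎
  where
  open ≡-Reasoning
  x+[y+z]≡y+[x+z] : ∀ x y z → x + (y + z) ≡ y + (x + z)
  x+[y+z]≡y+[x+z] = solve-∀
insertAt-true-sum (x ∷ a) (Fin.suc p) M (false ∷ B) = insertAt-true-sum a p M B

∣insertAt-false∣ : ∀ {m} p (B : Subset m) → ∣ insertAt B p false ∣ ≡ ∣ B ∣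
∣insertAt-false∣ Fin.zero B = refl
∣insertAt-false∣ (Fin.suc p) (true ∷ B) = cong suc (∣insertAt-false∣ p B)
∣insertAt-false∣ (Fin.suc p) (false ∷ B) = ∣insertAt-false∣ p B

∣insertAt-true∣ : ∀ {m} p (B : Subset m) → ∣ insertAt B p true ∣ ≡ suc ∣ B ∣
∣insertAt-true∣ Fin.zero B = refl
∣insertAt-true∣ (Fin.suc p) (true ∷ B) = cong suc (∣insertAt-true∣ p B)
∣insertAt-true∣ (Fin.suc p) (false ∷ B) = ∣insertAt-true∣ p B

InSigma : ∀ {k} → Vec ℕ k → ℕ → ℕ → Set
InSigma {k} a α v = Σ (Subset k) λ B → α ≤ ∣ B ∣ × subsetSum a B ≡ v

allSubsets-complete : ∀ {k} (B : Subset k) → B ∈ allSubsets k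
allSubsets-complete [] = here refl
allSubsets-complete {suc k} (true ∷ B) = ∈-++⁺ˡ (∈-map⁺ (true ∷_) (allSubsets-complete B))
allSubsets-complete {suc k} (false ∷ B) =
  ∈-++⁺ʳ (map (true ∷_) (allSubsets k)) (∈-map⁺ (false ∷_) (allSubsets-complete B))

InSigma⇒∈ : ∀ {k} (a : Vec ℕ k) α {v} → InSigma a α v → v ∈ deduplicate _≟_ (sigmaList a α)
InSigma⇒∈ a α (B , α≤∣B∣ , refl) = ∈-deduplicate⁺ _≟_
  (∈-map⁺ (subsetSum a) (∈-filter⁺ (λ B → α ≤? ∣ B ∣) (allSubsets-complete B) α≤∣B∣))

∈⇒InSigma : ∀ {k} (a : Vec ℕ k) α {v} → v ∈ deduplicate _≟_ (sigmaList a α) → InSigma a α v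
∈⇒InSigma {k} a α v∈ with ∈-map⁻ (subsetSum a) (∈-deduplicate⁻ _≟_ (sigmaList a α) v∈)
... | B , B∈ , refl = B , proj₂ (∈-filter⁻ (λ B → α ≤? ∣ B ∣) {xs = allSubsets k} B∈) , refl

-- A vector with pairwise distinct entries, i.e. a k-element set.
Injective : ∀ {k} → Vec ℕ k → Set
Injective a = ∀ i j → lookup a i ≡ lookup a j → i ≡ j

record Witnesses {k} (a : Vec ℕ k) (α n : ℕ) : Set where
  field
    sums     : List ℕ
    distinct : Unique sums
    count    : length sums ≡ n
    attained : ∀ {v} → v ∈ sums → InSigma a α v

witnesses⇒card≥ : ∀ {k} {a : Vec ℕ k} {α n} → Witnesses a α n → n ≤ cardSigma a α
witnesses⇒card≥ {a = a} {α} w = subst (_≤ cardSigma a α) count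
  (unique-⊆⇒length-≤ sums _ distinct (λ v∈ → InSigma⇒∈ a α (attained v∈)))
  where open Witnesses w

addLargest : ∀ {m} (a : Vec ℕ m) p M {α n} → Injective a → (∀ i → lookup a i < M) → α ≤ m →
             Witnesses a α n → Witnesses (insertAt a p M) α (n + m)
addLargest {m} a p M {α} inj a<M α≤m w = record
  { sums     = sums ++ map new (allFin m)
  ; distinct = ++⁺ distinct (map⁺ new-injective (allFin⁺ m)) disjoint
  ; count    = trans (length-++ sums)
                 (cong₂ _+_ count (trans (length-map new (allFin m)) (length-tabulate (λ i → i))))
  ; attained = attained′
  }
  where
  open Witnesses w
  new : Fin m → ℕ
  new i = M + subsetSum a (allBut i)
  new-injective : ∀ {i j} → new i ≡ new j → i ≡ j
  new-injective {i} {j} eq = inj i j (+-cancelˡ-≡ (subsetSum a (allBut i)) _ _ (begin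
      subsetSum a (allBut i) + lookup a i ≡⟨ allBut-sum a i ⟩
      total a                             ≡⟨ sym (allBut-sum a j) ⟩
      subsetSum a (allBut j) + lookup a j ≡⟨ cong (_+ lookup a j) (+-cancelˡ-≡ M _ _ (sym eq)) ⟩
      subsetSum a (allBut i) + lookup a j ∎))
    where open ≡-Reasoning
  new>total : ∀ i → total a < new i
  new>total i = subst (_< new i) (trans (+-comm (lookup a i) _) (allBut-sum a i))
    (+-monoˡ-< (subsetSum a (allBut i)) (a<M i))
  disjoint : ∀ {v} → ¬ (v ∈ sums × v ∈ map new (allFin m))
  disjoint (v∈old , v∈new) with ∈-map⁻ new v∈new | attained v∈old
  ... | i , _ , refl | B , _ , sumB≡ = <⇒≱ (new>total i) (subst (_≤ total a) sumB≡ (subsetSum≤total a B))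
  attained′ : ∀ {v} → v ∈ sums ++ map new (allFin m) → InSigma (insertAt a p M) α v
  attained′ v∈ with ∈-++⁻ sums v∈
  ... | inj₁ v∈old with attained v∈old
  ...   | B , α≤∣B∣ , sumB≡ = insertAt B p false ,
          subst (α ≤_) (sym (∣insertAt-false∣ p B)) α≤∣B∣ , trans (insertAt-false-sum a p M B) sumB≡
  attained′ v∈ | inj₂ v∈new with ∈-map⁻ new v∈new
  ... | i , _ , refl = insertAt (allBut i) p true ,
          subst (α ≤_) (sym (trans (∣insertAt-true∣ p (allBut i)) (∣allBut∣ i))) α≤m ,
          insertAt-true-sum a p M (allBut i)

argmax : ∀ {m} (a : Vec ℕ (suc m)) → Σ (Fin (suc m)) λ p → ∀ i → lookup a i ≤ lookup a p
argmax (x ∷ []) = Fin.zero , λ { Fin.zero → ≤-refl }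
argmax (x ∷ xs@(_ ∷ _)) with argmax xs
... | p , max with x ≤? lookup xs p
...   | yes x≤ = Fin.suc p , λ { Fin.zero → x≤ ; (Fin.suc i) → max i }
...   | no x≰ = Fin.zero , λ { Fin.zero → ≤-refl ; (Fin.suc i) → ≤-trans (max i) (<⇒≤ (≰⇒> x≰)) }

splitMax : ∀ {m} (a : Vec ℕ (suc m)) → Injective a →
           Σ (Fin (suc m)) λ p → Σ (Vec ℕ m) λ a′ →
             a ≡ insertAt a′ p (lookup a p) × Injective a′ × (∀ i → lookup a′ i < lookup a p)
splitMax a inj with argmax a
... | p , max = p , removeAt a p , sym (insertAt-removeAt a p) , inj′ , below
  where
  lookup-removeAt : ∀ i → lookup (removeAt a p) i ≡ lookup a (punchIn p i)
  lookup-removeAt i = trans (sym (insertAt-punchIn (removeAt a p) p (lookup a p) i))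
    (cong (λ b → lookup b (punchIn p i)) (insertAt-removeAt a p))
  inj′ : Injective (removeAt a p)
  inj′ i j eq = punchIn-injective p i j
    (inj _ _ (trans (sym (lookup-removeAt i)) (trans eq (lookup-removeAt j))))
  below : ∀ i → lookup (removeAt a p) i < lookup a p
  below i = subst (_< lookup a p) (sym (lookup-removeAt i))
    (≤∧≢⇒< (max (punchIn p i)) (λ eq → punchInᵢ≢i p i (inj _ _ eq)))

totalWitness : ∀ {k} (a : Vec ℕ k) → Witnesses a k 1
totalWitness {k} a = record
  { sums = total a ∷ []
  ; distinct = All.[] AllPairs.∷ AllPairs.[]
  ; count = refl
  ; attained = λ { (here refl) → full k , ≤-reflexive (sym (∣full∣ k)) , refl }
  }

lowerBound : ∀ k (a : Vec ℕ k) → Injective a → ∀ α → α ≤ k → Witnesses a α (T k ∸ T α + 1)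
lowerBound zero [] _ zero z≤n = totalWitness []
lowerBound (suc m) a inj α α≤k with α ≤? m
... | no α≰m with ≤-antisym α≤k (≰⇒> α≰m)
...   | refl = subst (Witnesses a α) (cong (_+ 1) (sym (n∸n≡0 (T α)))) (totalWitness a)
lowerBound (suc m) a inj α α≤k | yes α≤m with splitMax a inj
... | p , a′ , a≡ , inj′ , below = subst₂ (λ b n → Witnesses b α n) (sym a≡) (T-interval-step m α α≤m)
        (addLargest a′ p (lookup a p) inj′ below α≤m (lowerBound m a′ inj′ α α≤m))

-- The extremal set {0, 1, ..., k-1}, listed as (k-1, ..., 1, 0).

interval : ∀ n → Vec ℕ n
interval zero = []
interval (suc n) = n ∷ interval n

interval-< : ∀ n (i : Fin n) → lookup (interval n) i < n
interval-< (suc n) Fin.zero = ≤-refl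
interval-< (suc n) (Fin.suc i) = m≤n⇒m≤1+n (interval-< n i)

interval-injective : ∀ n → Injective (interval n)
interval-injective (suc n) Fin.zero Fin.zero _ = refl
interval-injective (suc n) Fin.zero (Fin.suc j) eq = ⊥-elim (<-irrefl (sym eq) (interval-< n j))
interval-injective (suc n) (Fin.suc i) Fin.zero eq = ⊥-elim (<-irrefl eq (interval-< n i))
interval-injective (suc n) (Fin.suc i) (Fin.suc j) eq = cong Fin.suc (interval-injective n i j eq)

interval-last : ∀ m → lookup (interval (suc m)) (Fin.fromℕ m) ≡ 0
interval-last zero = refl
interval-last (suc m) = interval-last m

interval-total : ∀ n → total (interval n) ≡ T n
interval-total zero = refl
interval-total (suc n) = cong (n +_) (interval-total n)

interval-sum≥ : ∀ n (B : Subset n) → T ∣ B ∣ ≤ subsetSum (interval n) B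
interval-sum≥ zero [] = z≤n
interval-sum≥ (suc n) (true ∷ B) = +-mono-≤ (∣B∣≤n B) (interval-sum≥ n B)
interval-sum≥ (suc n) (false ∷ B) = interval-sum≥ n B

-- Σ_α({0, ..., k-1}) ⊆ [T α, T k].
upperBound : ∀ k α → cardSigma (interval k) α ≤ T k ∸ T α + 1
upperBound k α = subst (cardSigma (interval k) α ≤_) range-length
    (unique-⊆⇒length-≤ _ range (deduplicate-! (sigmaList (interval k) α)) ⊆range)
  where
  range = map (T α +_) (upTo (T k ∸ T α + 1))
  range-length : length range ≡ T k ∸ T α + 1
  range-length = trans (length-map (T α +_) (upTo (T k ∸ T α + 1))) (length-upTo (T k ∸ T α + 1))
  ⊆range : ∀ {v} → v ∈ deduplicate _≟_ (sigmaList (interval k) α) → v ∈ range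
  ⊆range v∈ with ∈⇒InSigma (interval k) α v∈
  ... | B , α≤∣B∣ , refl = subst (_∈ range) (m+[n∸m]≡n lo)
        (∈-map⁺ (T α +_) (∈-upTo⁺ (subst (v ∸ T α <_) (+-comm 1 (T k ∸ T α))
           (s≤s (∸-monoˡ-≤ (T α) hi)))))
    where
    v = subsetSum (interval k) B
    lo : T α ≤ v
    lo = ≤-trans (T-mono α≤∣B∣) (interval-sum≥ k B)
    hi : v ≤ T k
    hi = subst (v ≤_) (interval-total k) (subsetSum≤total (interval k) B)

corollary2p1 : (k α : ℕ) → 2 ≤ k → α ≤ k →
    ((a : Vec ℕ k) → (∀ i j → lookup a i ≡ lookup a j → i ≡ j) → (∃ λ i → lookup a i ≡ 0) →
    cardSigma a α ≥ bound k α)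
    × (Σ (Vec ℕ k) λ a → (∀ i j → lookup a i ≡ lookup a j → i ≡ j) × (∃ λ i → lookup a i ≡ 0) ×
    cardSigma a α ≡ bound k α)
corollary2p1 k@(suc m) α _ α≤k =
    (λ a inj _ → subst (_≤ cardSigma a α) (sym (bound≡ k α)) (card≥ a inj))
  , interval k , interval-injective k , (Fin.fromℕ m , interval-last m)
  , trans (≤-antisym (upperBound k α) (card≥ (interval k) (interval-injective k))) (sym (bound≡ k α))
  where
  card≥ : (a : Vec ℕ k) → Injective a → T k ∸ T α + 1 ≤ cardSigma a α
  card≥ a inj = witnesses⇒card≥ (lowerBound k a inj α α≤k)
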